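{- Let $f(n)=\sum_{j=0}^{n}(-1)^{j}S(n,j)$ for $n\ge 0$, and let $F(x)=\sum_{n\ge 0}f(n)x^n\in\mathbb{Z}[[x]]$. Let $m$ be a positive integer, and set $$D(x)=(1-x)(1-2x)\cdots(1-(m-1)x)-(-1)^m x^m,\qquad Q(x)=\Biggl(\sum_{k=0}^{m-1}\frac{(-1)^k x^k}{(1-x)(1-2x)\cdots(1-kx)}\Biggr)(1-x)(1-2x)\cdots(1-(m-1)x),$$ so that $Q(x)$ is a polynomial with integer coefficients and $D(x)$ has constant term $1$. Then, as formal power series, $$F(x)\equiv \frac{Q(x)}{D(x)} \pmod m,$$ i.e. the coefficients of $F(x)D(x)-Q(x)$ are all divisible by $m$.
   Context: $S(n,k)$ denotes the Stirling number of the second kind (number of partitions of an $n$-element set into $k$ nonempty blocks, $S(0,0)=1$). -}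

module Defs where

open import Data.Nat as ℕ using (ℕ; zero; suc; _≡ᵇ_)
open import Data.Bool using (if_then_else_)
open import Data.Integer using (ℤ; +_; -_; _+_; _-_; _*_; _^_)

S : ℕ → ℕ → ℕ
S zero zero = 1
S zero (suc k) = 0
S (suc n) zero = 0
S (suc n) (suc k) = suc k ℕ.* S n (suc k) ℕ.+ S n k

sumBelow : ℕ → (ℕ → ℤ) → ℤ
sumBelow zero g = + 0
sumBelow (suc n) g = sumBelow n g + g n

PS : Set
PS = ℕ → ℤ

_⊛_ : PS → PS → PS
(a ⊛ b) n = sumBelow (suc n) (λ j → a j * b (n ℕ.∸ j))

_⊕_ : PS → PS → PS
(a ⊕ b) n = a n + b n

_⊖_ : PS → PS → PS
(a ⊖ b) n = a n - b n

mono : ℤ → ℕ → PS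
mono c k n = if n ≡ᵇ k then c else + 0

one : PS
one = mono (+ 1) 0

oneMinus : ℕ → PS
oneMinus c zero = + 1
oneMinus c (suc zero) = - (+ c)
oneMinus c (suc (suc n)) = + 0

invOneMinus : ℕ → PS
invOneMinus c n = + (c ℕ.^ n)

prodFrom1 : ℕ → (ℕ → PS) → PS
prodFrom1 zero p = one
prodFrom1 (suc k) p = prodFrom1 k p ⊛ p (suc k)

sumPS : ℕ → (ℕ → PS) → PS
sumPS zero s = λ _ → + 0
sumPS (suc n) s = sumPS n s ⊕ s n

f : ℕ → ℤ
f n = sumBelow (suc n) (λ j → (- (+ 1)) ^ j * + (S n j))

F : PS
F = f

P : ℕ → PS
P k = prodFrom1 k oneMinus

D : ℕ → PS
D m = P (m ℕ.∸ 1) ⊖ mono ((- (+ 1)) ^ m) m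

Q : ℕ → PS
Q m = sumPS m (λ k → mono ((- (+ 1)) ^ k) k ⊛ prodFrom1 k invOneMinus) ⊛ P (m ℕ.∸ 1)

-- Let T k = Σₙ S(n,k) xⁿ be the k-th column of the Stirling triangle. The recurrence for S says
-- (1 - kx) T k = x T (k-1), hence T k (1-x)⋯(1-kx) = xᵏ; so F = Σₖ (-1)ᵏ T k and
-- Q = (Σ_{k<m} (-1)ᵏ T k) (1-x)⋯(1-(m-1)x). Modulo m the factor 1 - cx depends only on c mod m and
-- can be cancelled (its constant term is 1), so induction on k gives
-- T (k+m) (1-x)⋯(1-(m-1)x) ≡ xᵐ T k (mod m). Summing over k ≥ m, the tail of F times
-- (1-x)⋯(1-(m-1)x) is ≡ (-1)ᵐ xᵐ F, that is F (1-x)⋯(1-(m-1)x) ≡ Q + (-1)ᵐ xᵐ F, which is F D ≡ Q.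
-- The infinite sum F is handled through its partial sums, which agree with F below their length.

module Submission where

open import Defs
open import Data.Nat using (ℕ; _≥_)
open import Data.Integer using (+_; _-_)
open import Data.Integer.Divisibility using (_∣_)

open import Algebra.Bundles using (CommutativeMonoid)
import Algebra.Properties.CommutativeSemigroup as CommutativeSemigroupProperties
open import Data.Integer using (ℤ; _+_; _*_; _^_; -_; 0ℤ; 1ℤ)
import Data.Integer.Divisibility.Signed as Signed
import Data.Integer.Properties as ℤₚ
open import Data.Integer.Tactic.RingSolver using (solve-∀)
open import Data.Nat as ℕ using (zero; suc; _≤_; _<_; s≤s; _≤′_; ≤′-refl; ≤′-step; _∸_)
import Data.Nat.Properties as ℕₚ
open import Data.Bool using (true; false)
open import Data.Product using (_,_)
open import Function using (_∘_)
open import Relation.Binary.Bundles using (Setoid; Preorder)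
open import Relation.Binary.PropositionalEquality
import Relation.Binary.Reasoning.Preorder
import Relation.Binary.Reasoning.Setoid

-- Finite sums

sumBelow-cong : ∀ n {g h : ℕ → ℤ} → (∀ i → i < n → g i ≡ h i) → sumBelow n g ≡ sumBelow n h
sumBelow-cong zero    e = refl
sumBelow-cong (suc n) e =
  cong₂ _+_ (sumBelow-cong n (λ i i<n → e i (ℕₚ.m<n⇒m<1+n i<n))) (e n ℕₚ.≤-refl)

sumBelow-ext : ∀ n {g h : ℕ → ℤ} → g ≗ h → sumBelow n g ≡ sumBelow n h
sumBelow-ext n e = sumBelow-cong n (λ i _ → e i)

sumBelow-zero : ∀ n {g : ℕ → ℤ} → (∀ i → i < n → g i ≡ 0ℤ) → sumBelow n g ≡ 0ℤ
sumBelow-zero zero    e = refl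
sumBelow-zero (suc n) e =
  cong₂ _+_ (sumBelow-zero n (λ i i<n → e i (ℕₚ.m<n⇒m<1+n i<n))) (e n ℕₚ.≤-refl)

sumBelow-+ : ∀ n (g h : ℕ → ℤ) → sumBelow n (λ i → g i + h i) ≡ sumBelow n g + sumBelow n h
sumBelow-+ zero    g h = refl
sumBelow-+ (suc n) g h = trans (cong (_+ (g n + h n)) (sumBelow-+ n g h))
  (interchange (sumBelow n g) (sumBelow n h) (g n) (h n))
  where
  interchange : ∀ a b c d → (a + b) + (c + d) ≡ (a + c) + (b + d)
  interchange = solve-∀

sumBelow-sub : ∀ n (g h : ℕ → ℤ) → sumBelow n (λ i → g i - h i) ≡ sumBelow n g - sumBelow n h
sumBelow-sub zero    g h = refl
sumBelow-sub (suc n) g h = trans (cong (_+ (g n - h n)) (sumBelow-sub n g h))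
  (interchange (sumBelow n g) (sumBelow n h) (g n) (h n))
  where
  interchange : ∀ a b c d → (a - b) + (c - d) ≡ (a + c) - (b + d)
  interchange = solve-∀

*-distribˡ-sumBelow : ∀ n c (g : ℕ → ℤ) → c * sumBelow n g ≡ sumBelow n (λ i → c * g i)
*-distribˡ-sumBelow zero    c g = ℤₚ.*-zeroʳ c
*-distribˡ-sumBelow (suc n) c g = trans (ℤₚ.*-distribˡ-+ c _ _)
  (cong (_+ c * g n) (*-distribˡ-sumBelow n c g))

*-distribʳ-sumBelow : ∀ n c (g : ℕ → ℤ) → sumBelow n g * c ≡ sumBelow n (λ i → g i * c)
*-distribʳ-sumBelow n c g =
  trans (ℤₚ.*-comm _ c) (trans (*-distribˡ-sumBelow n c g) (sumBelow-ext n (λ i → ℤₚ.*-comm c (g i))))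

sumBelow-suc-head : ∀ n (g : ℕ → ℤ) → sumBelow (suc n) g ≡ g 0 + sumBelow n (g ∘ suc)
sumBelow-suc-head zero    g = trans (ℤₚ.+-identityˡ (g 0)) (sym (ℤₚ.+-identityʳ (g 0)))
sumBelow-suc-head (suc n) g = trans (cong (_+ g (suc n)) (sumBelow-suc-head n g)) (ℤₚ.+-assoc (g 0) _ _)

sumBelow-reverse : ∀ n (g : ℕ → ℤ) → sumBelow n g ≡ sumBelow n (λ i → g (n ∸ suc i))
sumBelow-reverse zero    g = refl
sumBelow-reverse (suc n) g = trans (cong (_+ g n) (sumBelow-reverse n g))
  (trans (ℤₚ.+-comm _ (g n)) (sym (sumBelow-suc-head n (λ i → g (n ∸ i)))))

sumBelow-vanishing-tail : ∀ {n N} (g : ℕ → ℤ) → (∀ i → n ≤ i → g i ≡ 0ℤ) → n ≤′ N →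
  sumBelow N g ≡ sumBelow n g
sumBelow-vanishing-tail g vanish ≤′-refl         = refl
sumBelow-vanishing-tail g vanish (≤′-step {N} n≤N) =
  trans (cong₂ _+_ (sumBelow-vanishing-tail g vanish n≤N) (vanish N (ℕₚ.≤′⇒≤ n≤N))) (ℤₚ.+-identityʳ _)

sumBelow-triangle : ∀ N (g : ℕ → ℕ → ℤ) →
  sumBelow (suc N) (λ i → sumBelow (suc (N ∸ i)) (g i)) ≡
  sumBelow (suc N) (λ t → sumBelow (suc t) (λ i → g i (t ∸ i)))
sumBelow-triangle zero    g = refl
sumBelow-triangle (suc N) g = begin
    sumBelow (suc N) (λ i → sumBelow (suc (suc N ∸ i)) (g i)) + sumBelow (suc (N ∸ N)) (g (suc N))
  ≡⟨ cong₂ _+_ (sumBelow-cong (suc N) λ i i≤N → cong (λ k → sumBelow (suc k) (g i)) (suc-∸ i≤N))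
               corner ⟩
    sumBelow (suc N) (λ i → sumBelow (suc (N ∸ i)) (g i) + g i (suc (N ∸ i))) + g (suc N) (N ∸ N)
  ≡⟨ cong (_+ g (suc N) (N ∸ N)) (sumBelow-+ (suc N) _ _) ⟩
    (sumBelow (suc N) (λ i → sumBelow (suc (N ∸ i)) (g i)) + B) + g (suc N) (N ∸ N)
  ≡⟨ cong (λ s → (s + B) + g (suc N) (N ∸ N)) (sumBelow-triangle N g) ⟩
    (R + B) + g (suc N) (N ∸ N)
  ≡⟨ ℤₚ.+-assoc R B _ ⟩
    R + (B + g (suc N) (N ∸ N))
  ≡⟨ cong (λ s → R + (s + g (suc N) (N ∸ N)))
          (sumBelow-cong (suc N) (λ i i≤N → cong (g i) (sym (suc-∸ i≤N)))) ⟩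
    R + sumBelow (suc (suc N)) (λ i → g i (suc N ∸ i))
  ∎
  where
  open ≡-Reasoning
  R = sumBelow (suc N) (λ t → sumBelow (suc t) (λ i → g i (t ∸ i)))
  B = sumBelow (suc N) (λ i → g i (suc (N ∸ i)))
  suc-∸ : ∀ {i} → i < suc N → suc N ∸ i ≡ suc (N ∸ i)
  suc-∸ i<1+N = ℕₚ.+-∸-assoc 1 (ℕₚ.≤-pred i<1+N)
  corner : sumBelow (suc (N ∸ N)) (g (suc N)) ≡ g (suc N) (N ∸ N)
  corner rewrite ℕₚ.n∸n≡0 N = ℤₚ.+-identityˡ _

∣-sumBelow : ∀ {d} n (g : ℕ → ℤ) → (∀ i → d Signed.∣ g i) → d Signed.∣ sumBelow n g
∣-sumBelow zero    g d∣g = Signed.divides 0ℤ refl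
∣-sumBelow (suc n) g d∣g = Signed.∣m∣n⇒∣m+n (∣-sumBelow n g d∣g) (d∣g n)

-- Formal power series

PS-setoid : Setoid _ _
PS-setoid = ℕ →-setoid ℤ

⊛-congˡ-≤ : ∀ {a b} c n → (∀ j → j ≤ n → a j ≡ b j) → (a ⊛ c) n ≡ (b ⊛ c) n
⊛-congˡ-≤ c n e = sumBelow-cong (suc n) (λ j j≤n → cong (_* c (n ∸ j)) (e j (ℕₚ.≤-pred j≤n)))

⊛-cong : ∀ {a b c d} → a ≗ b → c ≗ d → a ⊛ c ≗ b ⊛ d
⊛-cong e e′ n = sumBelow-ext (suc n) (λ j → cong₂ _*_ (e j) (e′ (n ∸ j)))

⊛-comm : ∀ a b → a ⊛ b ≗ b ⊛ a
⊛-comm a b n = trans (sumBelow-reverse (suc n) _) (sumBelow-cong (suc n) λ i i≤n →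
  trans (cong (λ k → a (n ∸ i) * b k) (ℕₚ.m∸[m∸n]≡n (ℕₚ.≤-pred i≤n)))
        (ℤₚ.*-comm (a (n ∸ i)) (b i)))

⊛-assoc : ∀ a b c → (a ⊛ b) ⊛ c ≗ a ⊛ (b ⊛ c)
⊛-assoc a b c n = begin
    sumBelow (suc n) (λ t → sumBelow (suc t) (λ i → a i * b (t ∸ i)) * c (n ∸ t))
  ≡⟨ sumBelow-ext (suc n) (λ t → *-distribʳ-sumBelow (suc t) (c (n ∸ t)) _) ⟩
    sumBelow (suc n) (λ t → sumBelow (suc t) (λ i → a i * b (t ∸ i) * c (n ∸ t)))
  ≡⟨ sumBelow-ext (suc n) (λ t → sumBelow-cong (suc t) (λ i i≤t →
       trans (ℤₚ.*-assoc (a i) (b (t ∸ i)) (c (n ∸ t)))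
             (cong (λ k → a i * (b (t ∸ i) * c k)) (sym (∸-∸ (ℕₚ.≤-pred i≤t)))))) ⟩
    sumBelow (suc n) (λ t → sumBelow (suc t) (λ i → g i (t ∸ i)))
  ≡⟨ sumBelow-triangle n g ⟨
    sumBelow (suc n) (λ i → sumBelow (suc (n ∸ i)) (g i))
  ≡⟨ sumBelow-ext (suc n) (λ i → *-distribˡ-sumBelow (suc (n ∸ i)) (a i) _) ⟨
    (a ⊛ (b ⊛ c)) n
  ∎
  where
  open ≡-Reasoning
  g : ℕ → ℕ → ℤ
  g i j = a i * (b j * c (n ∸ i ∸ j))
  ∸-∸ : ∀ {i t} → i ≤ t → n ∸ i ∸ (t ∸ i) ≡ n ∸ t
  ∸-∸ {i} {t} i≤t = trans (ℕₚ.∸-+-assoc n i (t ∸ i)) (cong (n ∸_) (ℕₚ.m+[n∸m]≡n i≤t))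

⊛-identityˡ : ∀ a → one ⊛ a ≗ a
⊛-identityˡ a n = trans (sumBelow-suc-head n _)
  (trans (cong₂ _+_ (ℤₚ.*-identityˡ (a n)) (sumBelow-zero n (λ _ _ → refl))) (ℤₚ.+-identityʳ (a n)))

⊛-commutativeMonoid : CommutativeMonoid _ _
⊛-commutativeMonoid = record
  { Carrier = PS
  ; _≈_ = _≗_
  ; _∙_ = _⊛_
  ; ε = one
  ; isCommutativeMonoid = record
    { isMonoid = record
      { isSemigroup = record
        { isMagma = record { isEquivalence = Setoid.isEquivalence PS-setoid ; ∙-cong = ⊛-cong }
        ; assoc = ⊛-assoc
        }
      ; identity = ⊛-identityˡ , λ a n → trans (⊛-comm a one n) (⊛-identityˡ a n)
      }
    ; comm = ⊛-comm
    }
  }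

open CommutativeMonoid ⊛-commutativeMonoid
  using () renaming (identityʳ to ⊛-identityʳ; ∙-congˡ to ⊛-congˡ; ∙-congʳ to ⊛-congʳ)
open CommutativeSemigroupProperties (CommutativeMonoid.commutativeSemigroup ⊛-commutativeMonoid)
  using (interchange; x∙yz≈y∙zx)

module ≗-Reasoning = Relation.Binary.Reasoning.Setoid PS-setoid

⊛-distribʳ-⊕ : ∀ a b c → (a ⊕ b) ⊛ c ≗ (a ⊛ c) ⊕ (b ⊛ c)
⊛-distribʳ-⊕ a b c n =
  trans (sumBelow-ext (suc n) (λ j → ℤₚ.*-distribʳ-+ (c (n ∸ j)) (a j) (b j))) (sumBelow-+ (suc n) _ _)

⊛-distribˡ-⊖ : ∀ a b c → a ⊛ (b ⊖ c) ≗ (a ⊛ b) ⊖ (a ⊛ c)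
⊛-distribˡ-⊖ a b c n =
  trans (sumBelow-ext (suc n) (λ j → distrib (a j) (b (n ∸ j)) (c (n ∸ j)))) (sumBelow-sub (suc n) _ _)
  where
  distrib : ∀ x y z → x * (y - z) ≡ x * y - x * z
  distrib = solve-∀

infixr 7 _·_
_·_ : ℤ → PS → PS
(c · a) n = c * a n

·-⊛ : ∀ c a b → (c · a) ⊛ b ≗ c · (a ⊛ b)
·-⊛ c a b n = trans (sumBelow-ext (suc n) (λ j → ℤₚ.*-assoc c (a j) (b (n ∸ j))))
  (sym (*-distribˡ-sumBelow (suc n) c _))

·-⊛-· : ∀ c d a b → (c · a) ⊛ (d · b) ≗ (c * d) · (a ⊛ b)
·-⊛-· c d a b n = trans (sumBelow-ext (suc n) (λ j → rearrange c d (a j) (b (n ∸ j))))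
  (sym (*-distribˡ-sumBelow (suc n) (c * d) _))
  where
  rearrange : ∀ c d x y → (c * x) * (d * y) ≡ (c * d) * (x * y)
  rearrange = solve-∀

mono-· : ∀ c k → mono c k ≗ c · mono 1ℤ k
mono-· c k n with n ℕ.≡ᵇ k
... | true  = sym (ℤₚ.*-identityʳ c)
... | false = sym (ℤₚ.*-zeroʳ c)

sumPS-cong : ∀ N {s t : ℕ → PS} → (∀ k → s k ≗ t k) → sumPS N s ≗ sumPS N t
sumPS-cong zero    e n = refl
sumPS-cong (suc N) e n = cong₂ _+_ (sumPS-cong N e n) (e N n)

sumPS-⊛ : ∀ N (s : ℕ → PS) c → sumPS N s ⊛ c ≗ sumPS N (λ k → s k ⊛ c)
sumPS-⊛ zero    s c n = sumBelow-zero (suc n) (λ _ _ → refl)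
sumPS-⊛ (suc N) s c n = trans (⊛-distribʳ-⊕ (sumPS N s) (s N) c n)
  (cong (_+ (s N ⊛ c) n) (sumPS-⊛ N s c n))

sumPS-+ : ∀ N M (s : ℕ → PS) → sumPS (N ℕ.+ M) s ≗ sumPS M s ⊕ sumPS N (λ k → s (k ℕ.+ M))
sumPS-+ zero    M s n = sym (ℤₚ.+-identityʳ _)
sumPS-+ (suc N) M s n = trans (cong (_+ s (N ℕ.+ M) n) (sumPS-+ N M s n))
  (ℤₚ.+-assoc (sumPS M s n) (sumPS N (λ k → s (k ℕ.+ M)) n) (s (N ℕ.+ M) n))

sumPS-apply : ∀ N (s : ℕ → PS) n → sumPS N s n ≡ sumBelow N (λ k → s k n)
sumPS-apply zero    s n = refl
sumPS-apply (suc N) s n = cong (_+ s N n) (sumPS-apply N s n)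

-- Congruence of power series modulo m

-- A record rather than the bare function type, so that both series can be inferred from a proof.
infix 4 _≡[_]_
record _≡[_]_ (a : PS) (m : ℕ) (b : PS) : Set where
  constructor coefficientwise
  field divides : ∀ n → + m Signed.∣ a n - b n
open _≡[_]_

≗⇒≡[] : ∀ {m a b} → a ≗ b → a ≡[ m ] b
≗⇒≡[] e = coefficientwise (λ n → Signed.divides 0ℤ (ℤₚ.i≡j⇒i-j≡0 (e n)))

≡[]-trans : ∀ {m a b c} → a ≡[ m ] b → b ≡[ m ] c → a ≡[ m ] c
≡[]-trans {a = a} {b} {c} e e′ = coefficientwise λ n →
  subst (_ Signed.∣_) (telescope (a n) (b n) (c n)) (Signed.∣m∣n⇒∣m+n (divides e n) (divides e′ n))
  where
  telescope : ∀ x y z → (x - y) + (y - z) ≡ x - z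
  telescope = solve-∀

-- A preorder over _≗_, so that reasoning chains can mix ≈⟨_⟩ (equal series) and ≲⟨_⟩ (congruent ones).
≡[]-preorder : ℕ → Preorder _ _ _
≡[]-preorder m = record
  { Carrier = PS
  ; _≈_ = _≗_
  ; _≲_ = _≡[ m ]_
  ; isPreorder = record
    { isEquivalence = Setoid.isEquivalence PS-setoid
    ; reflexive = ≗⇒≡[]
    ; trans = ≡[]-trans
    }
  }

module ≡[]-Reasoning (m : ℕ) = Relation.Binary.Reasoning.Preorder (≡[]-preorder m)

≡[]-⊛ˡ : ∀ {m a b} c → a ≡[ m ] b → c ⊛ a ≡[ m ] c ⊛ b
≡[]-⊛ˡ {a = a} {b} c e = coefficientwise λ n → subst (_ Signed.∣_) (⊛-distribˡ-⊖ c a b n)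
  (∣-sumBelow (suc n) _ (λ j → Signed.∣n⇒∣m*n (c j) (divides e (n ∸ j))))

≡[]-⊛ʳ : ∀ {m a b} c → a ≡[ m ] b → a ⊛ c ≡[ m ] b ⊛ c
≡[]-⊛ʳ {m} {a} {b} c e = begin
  a ⊛ c  ≈⟨ ⊛-comm a c ⟩
  c ⊛ a  ≲⟨ ≡[]-⊛ˡ c e ⟩
  c ⊛ b  ≈⟨ ⊛-comm c b ⟩
  b ⊛ c  ∎
  where open ≡[]-Reasoning m

≡[]-⊕ : ∀ {m a b c d} → a ≡[ m ] b → c ≡[ m ] d → a ⊕ c ≡[ m ] b ⊕ d
≡[]-⊕ {a = a} {b} {c} {d} e e′ = coefficientwise λ n →
  subst (_ Signed.∣_) (regroup (a n) (b n) (c n) (d n)) (Signed.∣m∣n⇒∣m+n (divides e n) (divides e′ n))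
  where
  regroup : ∀ x y z w → (x - y) + (z - w) ≡ (x + z) - (y + w)
  regroup = solve-∀

≡[]-· : ∀ {m a b} c → a ≡[ m ] b → c · a ≡[ m ] c · b
≡[]-· {a = a} {b} c e = coefficientwise λ n →
  subst (_ Signed.∣_) (distrib c (a n) (b n)) (Signed.∣n⇒∣m*n c (divides e n))
  where
  distrib : ∀ x y z → x * (y - z) ≡ x * y - x * z
  distrib = solve-∀

≡[]-sumPS : ∀ {m} N {s t : ℕ → PS} → (∀ k → s k ≡[ m ] t k) → sumPS N s ≡[ m ] sumPS N t
≡[]-sumPS zero    e = ≗⇒≡[] (λ _ → refl)
≡[]-sumPS (suc N) e = ≡[]-⊕ (≡[]-sumPS N e) (e N)

-- Linear factors

X : PS
X = mono 1ℤ 1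

⊛-at-zero : ∀ a b → (a ⊛ b) 0 ≡ a 0 * b 0
⊛-at-zero a b = ℤₚ.+-identityˡ (a 0 * b 0)

linear-⊛-at-suc : ∀ b → (∀ i → b (suc (suc i)) ≡ 0ℤ) → ∀ a n →
  (b ⊛ a) (suc n) ≡ b 0 * a (suc n) + b 1 * a n
linear-⊛-at-suc b deg≤1 a n = begin
    (b ⊛ a) (suc n)
  ≡⟨ sumBelow-suc-head (suc n) _ ⟩
    b 0 * a (suc n) + sumBelow (suc n) (λ j → b (suc j) * a (n ∸ j))
  ≡⟨ cong (_+_ (b 0 * a (suc n))) (sumBelow-suc-head n _) ⟩
    b 0 * a (suc n) + (b 1 * a n + sumBelow n (λ j → b (suc (suc j)) * a (n ∸ suc j)))
  ≡⟨ cong (λ s → b 0 * a (suc n) + (b 1 * a n + s)) (sumBelow-zero n higher-terms) ⟩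
    b 0 * a (suc n) + (b 1 * a n + 0ℤ)
  ≡⟨ cong (_+_ (b 0 * a (suc n))) (ℤₚ.+-identityʳ (b 1 * a n)) ⟩
    b 0 * a (suc n) + b 1 * a n
  ∎
  where
  open ≡-Reasoning
  higher-terms : ∀ j → j < n → b (suc (suc j)) * a (n ∸ suc j) ≡ 0ℤ
  higher-terms j _ = trans (cong (_* a (n ∸ suc j)) (deg≤1 j)) (ℤₚ.*-zeroˡ (a (n ∸ suc j)))

oneMinus-⊛-at-zero : ∀ c a → (oneMinus c ⊛ a) 0 ≡ a 0
oneMinus-⊛-at-zero c a = trans (⊛-at-zero (oneMinus c) a) (ℤₚ.*-identityˡ (a 0))

oneMinus-⊛-at-suc : ∀ c a n → (oneMinus c ⊛ a) (suc n) ≡ a (suc n) - + c * a n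
oneMinus-⊛-at-suc c a n = trans (linear-⊛-at-suc (oneMinus c) (λ _ → refl) a n)
  (normalise (a (suc n)) (+ c) (a n))
  where
  normalise : ∀ x c y → 1ℤ * x + (- c) * y ≡ x - c * y
  normalise = solve-∀

X-⊛-at-zero : ∀ a → (X ⊛ a) 0 ≡ 0ℤ
X-⊛-at-zero a = ⊛-at-zero X a

X-⊛-at-suc : ∀ a n → (X ⊛ a) (suc n) ≡ a n
X-⊛-at-suc a n = trans (linear-⊛-at-suc X (λ _ → refl) a n)
  (trans (ℤₚ.+-identityˡ (1ℤ * a n)) (ℤₚ.*-identityˡ (a n)))

X-⊛-mono : ∀ c k → X ⊛ mono c k ≗ mono c (suc k)
X-⊛-mono c k zero    = X-⊛-at-zero (mono c k)
X-⊛-mono c k (suc n) = X-⊛-at-suc (mono c k) n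

oneMinus-⊛-invOneMinus : ∀ c → oneMinus c ⊛ invOneMinus c ≗ one
oneMinus-⊛-invOneMinus c zero    = oneMinus-⊛-at-zero c (invOneMinus c)
oneMinus-⊛-invOneMinus c (suc n) = trans (oneMinus-⊛-at-suc c (invOneMinus c) n)
  (ℤₚ.i≡j⇒i-j≡0 (ℤₚ.pos-* c (c ℕ.^ n)))

P-⊛-invP : ∀ k → P k ⊛ prodFrom1 k invOneMinus ≗ one
P-⊛-invP zero    = ⊛-identityˡ one
P-⊛-invP (suc k) n = begin
    ((P k ⊛ oneMinus (suc k)) ⊛ (prodFrom1 k invOneMinus ⊛ invOneMinus (suc k))) n
  ≡⟨ interchange (P k) (oneMinus (suc k)) (prodFrom1 k invOneMinus) (invOneMinus (suc k)) n ⟩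
    ((P k ⊛ prodFrom1 k invOneMinus) ⊛ (oneMinus (suc k) ⊛ invOneMinus (suc k))) n
  ≡⟨ ⊛-cong (P-⊛-invP k) (oneMinus-⊛-invOneMinus (suc k)) n ⟩
    (one ⊛ one) n
  ≡⟨ ⊛-identityˡ one n ⟩
    one n
  ∎
  where open ≡-Reasoning

oneMinus-≡[]-+ : ∀ c m → oneMinus c ≡[ m ] oneMinus (c ℕ.+ m)
oneMinus-≡[]-+ c m = coefficientwise λ
  { zero          → Signed.divides 0ℤ refl
  ; (suc zero)    → Signed.divides 1ℤ
                      (trans (cong (λ z → - (+ c) - - z) (ℤₚ.pos-+ c m)) (difference (+ c) (+ m)))
  ; (suc (suc n)) → Signed.divides 0ℤ refl
  }
  where
  difference : ∀ c m → - c - - (c + m) ≡ 1ℤ * m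
  difference = solve-∀

oneMinus-⊛-cancel : ∀ {m a b} c → oneMinus c ⊛ a ≡[ m ] oneMinus c ⊛ b → a ≡[ m ] b
oneMinus-⊛-cancel {m} {a} {b} c e = coefficientwise go
  where
  m∣om⊛diff : ∀ n → + m Signed.∣ (oneMinus c ⊛ (a ⊖ b)) n
  m∣om⊛diff n = subst (_ Signed.∣_) (sym (⊛-distribˡ-⊖ (oneMinus c) a b n)) (divides e n)
  go : ∀ n → + m Signed.∣ a n - b n
  go zero    = subst (_ Signed.∣_) (oneMinus-⊛-at-zero c (a ⊖ b)) (m∣om⊛diff 0)
  go (suc n) = Signed.∣m+n∣n⇒∣m
    (subst (_ Signed.∣_) (oneMinus-⊛-at-suc c (a ⊖ b) n) (m∣om⊛diff (suc n)))
    (Signed.∣m⇒∣-m (Signed.∣n⇒∣m*n (+ c) (go n)))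

-- Columns of the Stirling triangle

stirlingColumn : ℕ → PS
stirlingColumn k n = + S n k

S-vanishes : ∀ {n k} → n < k → S n k ≡ 0
S-vanishes {zero}  {suc k} _         = refl
S-vanishes {suc n} {suc k} (s≤s n<k) = cong₂ ℕ._+_
  (trans (cong (suc k ℕ.*_) (S-vanishes (ℕₚ.m<n⇒m<1+n n<k))) (ℕₚ.*-zeroʳ (suc k))) (S-vanishes n<k)

stirlingColumn-zero : stirlingColumn 0 ≗ one
stirlingColumn-zero zero    = refl
stirlingColumn-zero (suc n) = refl

stirlingColumn-rec : ∀ k → oneMinus (suc k) ⊛ stirlingColumn (suc k) ≗ X ⊛ stirlingColumn k
stirlingColumn-rec k zero    = trans (oneMinus-⊛-at-zero (suc k) (stirlingColumn (suc k)))
  (sym (X-⊛-at-zero (stirlingColumn k)))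
stirlingColumn-rec k (suc n) = begin
    (oneMinus (suc k) ⊛ stirlingColumn (suc k)) (suc n)
  ≡⟨ oneMinus-⊛-at-suc (suc k) (stirlingColumn (suc k)) n ⟩
    + (suc k ℕ.* S n (suc k) ℕ.+ S n k) - + suc k * + S n (suc k)
  ≡⟨ cong (_- + suc k * + S n (suc k))
       (trans (ℤₚ.pos-+ (suc k ℕ.* S n (suc k)) (S n k))
              (cong (_+ + S n k) (ℤₚ.pos-* (suc k) (S n (suc k))))) ⟩
    (+ suc k * + S n (suc k) + + S n k) - + suc k * + S n (suc k)
  ≡⟨ cancel (+ suc k * + S n (suc k)) (+ S n k) ⟩
    + S n k
  ≡⟨ X-⊛-at-suc (stirlingColumn k) n ⟨
    (X ⊛ stirlingColumn k) (suc n)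
  ∎
  where
  open ≡-Reasoning
  cancel : ∀ x y → (x + y) - x ≡ y
  cancel = solve-∀

stirlingColumn-⊛-P : ∀ k → stirlingColumn k ⊛ P k ≗ mono 1ℤ k
stirlingColumn-⊛-P zero    n = trans (⊛-identityʳ (stirlingColumn 0) n) (stirlingColumn-zero n)
stirlingColumn-⊛-P (suc k) = begin
  T (suc k) ⊛ (P k ⊛ c)    ≈⟨ x∙yz≈y∙zx (T (suc k)) (P k) c ⟩
  P k ⊛ (c ⊛ T (suc k))    ≈⟨ ⊛-congˡ {P k} (stirlingColumn-rec k) ⟩
  P k ⊛ (X ⊛ T k)          ≈⟨ x∙yz≈y∙zx (P k) X (T k) ⟩
  X ⊛ (T k ⊛ P k)          ≈⟨ ⊛-congˡ {X} (stirlingColumn-⊛-P k) ⟩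
  X ⊛ mono 1ℤ k            ≈⟨ X-⊛-mono 1ℤ k ⟩
  mono 1ℤ (suc k)          ∎
  where
  open ≗-Reasoning
  T = stirlingColumn
  c = oneMinus (suc k)

mono-⊛-invP : ∀ k → mono 1ℤ k ⊛ prodFrom1 k invOneMinus ≗ stirlingColumn k
mono-⊛-invP k = begin
  mono 1ℤ k ⊛ I                     ≈⟨ ⊛-congʳ {I} (stirlingColumn-⊛-P k) ⟨
  (stirlingColumn k ⊛ P k) ⊛ I      ≈⟨ ⊛-assoc (stirlingColumn k) (P k) I ⟩
  stirlingColumn k ⊛ (P k ⊛ I)      ≈⟨ ⊛-congˡ {stirlingColumn k} (P-⊛-invP k) ⟩
  stirlingColumn k ⊛ one            ≈⟨ ⊛-identityʳ (stirlingColumn k) ⟩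
  stirlingColumn k                  ∎
  where
  open ≗-Reasoning
  I = prodFrom1 k invOneMinus

one≗oneMinus-zero : one ≗ oneMinus 0
one≗oneMinus-zero zero          = refl
one≗oneMinus-zero (suc zero)    = refl
one≗oneMinus-zero (suc (suc n)) = refl

stirlingColumn-shift : ∀ m′ k →
  stirlingColumn (k ℕ.+ suc m′) ⊛ P m′ ≡[ suc m′ ] stirlingColumn k ⊛ mono 1ℤ (suc m′)
stirlingColumn-shift m′ zero = begin
  T m ⊛ P m′                       ≈⟨ ⊛-identityʳ (T m ⊛ P m′) ⟨
  (T m ⊛ P m′) ⊛ one               ≈⟨ ⊛-congˡ {T m ⊛ P m′} one≗oneMinus-zero ⟩
  (T m ⊛ P m′) ⊛ oneMinus 0        ≲⟨ ≡[]-⊛ˡ (T m ⊛ P m′) (oneMinus-≡[]-+ 0 m) ⟩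
  (T m ⊛ P m′) ⊛ oneMinus m        ≈⟨ ⊛-assoc (T m) (P m′) (oneMinus m) ⟩
  T m ⊛ P m                        ≈⟨ stirlingColumn-⊛-P m ⟩
  mono 1ℤ m                        ≈⟨ ⊛-identityˡ (mono 1ℤ m) ⟨
  one ⊛ mono 1ℤ m                  ≈⟨ ⊛-congʳ {mono 1ℤ m} stirlingColumn-zero ⟨
  T 0 ⊛ mono 1ℤ m                  ∎
  where
  m = suc m′
  T = stirlingColumn
  open ≡[]-Reasoning m
stirlingColumn-shift m′ (suc k) = oneMinus-⊛-cancel (suc k) (begin
  c ⊛ (T (suc j) ⊛ P m′)                ≈⟨ ⊛-assoc c (T (suc j)) (P m′) ⟨
  (c ⊛ T (suc j)) ⊛ P m′                ≲⟨ ≡[]-⊛ʳ (P m′) (≡[]-⊛ʳ (T (suc j)) (oneMinus-≡[]-+ (suc k) m)) ⟩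
  (oneMinus (suc j) ⊛ T (suc j)) ⊛ P m′  ≈⟨ ⊛-congʳ {P m′} (stirlingColumn-rec j) ⟩
  (X ⊛ T j) ⊛ P m′                      ≈⟨ ⊛-assoc X (T j) (P m′) ⟩
  X ⊛ (T j ⊛ P m′)                      ≲⟨ ≡[]-⊛ˡ X (stirlingColumn-shift m′ k) ⟩
  X ⊛ (T k ⊛ mono 1ℤ m)                 ≈⟨ ⊛-assoc X (T k) (mono 1ℤ m) ⟨
  (X ⊛ T k) ⊛ mono 1ℤ m                 ≈⟨ ⊛-congʳ {mono 1ℤ m} (stirlingColumn-rec k) ⟨
  (c ⊛ T (suc k)) ⊛ mono 1ℤ m           ≈⟨ ⊛-assoc c (T (suc k)) (mono 1ℤ m) ⟩
  c ⊛ (T (suc k) ⊛ mono 1ℤ m)           ∎)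
  where
  m = suc m′
  j = k ℕ.+ m
  T = stirlingColumn
  c = oneMinus (suc k)
  open ≡[]-Reasoning m

-- Alternating sums of columns

sign : ℕ → ℤ
sign k = (- 1ℤ) ^ k

sign-+ : ∀ k m → sign (k ℕ.+ m) ≡ sign k * sign m
sign-+ = ℤₚ.^-distribˡ-+-* (- 1ℤ)

signedColumn : ℕ → PS
signedColumn k = sign k · stirlingColumn k

signedColumn-shift : ∀ m′ k →
  signedColumn (k ℕ.+ suc m′) ⊛ P m′ ≡[ suc m′ ] signedColumn k ⊛ mono (sign (suc m′)) (suc m′)
signedColumn-shift m′ k = begin
  (sign j · T j) ⊛ P m′                    ≈⟨ ·-⊛ (sign j) (T j) (P m′) ⟩
  sign j · (T j ⊛ P m′)                    ≲⟨ ≡[]-· (sign j) (stirlingColumn-shift m′ k) ⟩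
  sign j · (T k ⊛ mono 1ℤ m)               ≈⟨ (λ n → cong (_* (T k ⊛ mono 1ℤ m) n) (sign-+ k m)) ⟩
  (sign k * sign m) · (T k ⊛ mono 1ℤ m)    ≈⟨ ·-⊛-· (sign k) (sign m) (T k) (mono 1ℤ m) ⟨
  (sign k · T k) ⊛ (sign m · mono 1ℤ m)    ≈⟨ ⊛-congˡ {sign k · T k} (mono-· (sign m) m) ⟨
  (sign k · T k) ⊛ mono (sign m) m         ∎
  where
  m = suc m′
  j = k ℕ.+ m
  T = stirlingColumn
  open ≡[]-Reasoning m

mono-sign-⊛-invP : ∀ k → mono (sign k) k ⊛ prodFrom1 k invOneMinus ≗ signedColumn k
mono-sign-⊛-invP k = begin
  mono (sign k) k ⊛ I             ≈⟨ ⊛-congʳ {I} (mono-· (sign k) k) ⟩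
  (sign k · mono 1ℤ k) ⊛ I        ≈⟨ ·-⊛ (sign k) (mono 1ℤ k) I ⟩
  sign k · (mono 1ℤ k ⊛ I)        ≈⟨ (λ n → cong (sign k *_) (mono-⊛-invP k n)) ⟩
  sign k · stirlingColumn k       ∎
  where
  open ≗-Reasoning
  I = prodFrom1 k invOneMinus

partialF : ℕ → PS
partialF N = sumPS N signedColumn

partialF-agrees : ∀ {N j} → j < N → partialF N j ≡ F j
partialF-agrees {N} {j} j<N = trans (sumPS-apply N signedColumn j)
  (sumBelow-vanishing-tail (λ k → signedColumn k j) vanish (ℕₚ.≤⇒≤′ j<N))
  where
  vanish : ∀ i → j < i → signedColumn i j ≡ 0ℤ
  vanish i j<i = trans (cong (λ s → sign i * + s) (S-vanishes j<i)) (ℤₚ.*-zeroʳ (sign i))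

F-⊛-truncate : ∀ c {n N} → n < N → (F ⊛ c) n ≡ (partialF N ⊛ c) n
F-⊛-truncate c {n} n<N = ⊛-congˡ-≤ c n (λ j j≤n → sym (partialF-agrees (ℕₚ.≤-<-trans j≤n n<N)))

Q≗partialF-⊛-P : ∀ m′ → Q (suc m′) ≗ partialF (suc m′) ⊛ P m′
Q≗partialF-⊛-P m′ = ⊛-congʳ {P m′} (sumPS-cong (suc m′) mono-sign-⊛-invP)

partialTail : ℕ → ℕ → PS
partialTail m N = sumPS N (λ k → signedColumn (k ℕ.+ m))

F-⊛-split : ∀ m c n → (F ⊛ c) n ≡ (partialF m ⊛ c) n + (partialTail m (suc n) ⊛ c) n
F-⊛-split m c n = begin
  (F ⊛ c) n                                 ≡⟨ F-⊛-truncate c (ℕₚ.m≤m+n (suc n) m) ⟩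
  (partialF (suc n ℕ.+ m) ⊛ c) n            ≡⟨ ⊛-congʳ {c} (sumPS-+ (suc n) m signedColumn) n ⟩
  ((partialF m ⊕ tail) ⊛ c) n               ≡⟨ ⊛-distribʳ-⊕ (partialF m) tail c n ⟩
  (partialF m ⊛ c) n + (tail ⊛ c) n         ∎
  where
  open ≡-Reasoning
  tail = partialTail m (suc n)

partialTail-⊛-P : ∀ m′ N →
  partialTail (suc m′) N ⊛ P m′ ≡[ suc m′ ] partialF N ⊛ mono (sign (suc m′)) (suc m′)
partialTail-⊛-P m′ N = begin
  partialTail m N ⊛ P m′                        ≈⟨ sumPS-⊛ N (λ k → signedColumn (k ℕ.+ m)) (P m′) ⟩
  sumPS N (λ k → signedColumn (k ℕ.+ m) ⊛ P m′) ≲⟨ ≡[]-sumPS N (signedColumn-shift m′) ⟩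
  sumPS N (λ k → signedColumn k ⊛ M)            ≈⟨ sumPS-⊛ N signedColumn M ⟨
  partialF N ⊛ M                                ∎
  where
  m = suc m′
  M = mono (sign m) m
  open ≡[]-Reasoning m

lemma2p1 : (m : ℕ) → m ≥ 1 → (n : ℕ) → (+ m) ∣ (((F ⊛ D m) n) - Q m n)
lemma2p1 (suc m′) _ n =
  Signed.∣⇒∣ᵤ (subst (_ Signed.∣_) rearrange (divides (partialTail-⊛-P m′ (suc n)) n))
  where
  open ≡-Reasoning
  m = suc m′
  M = mono (sign m) m
  Q′ = (partialF m ⊛ P m′) n
  cancel : ∀ x y z → (x + y) - z - x ≡ y - z
  cancel = solve-∀
  rearrange : (partialTail m (suc n) ⊛ P m′) n - (partialF (suc n) ⊛ M) n ≡ (F ⊛ D m) n - Q m n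
  rearrange = begin
    (partialTail m (suc n) ⊛ P m′) n - (partialF (suc n) ⊛ M) n
      ≡⟨ cancel Q′ _ _ ⟨
    (Q′ + (partialTail m (suc n) ⊛ P m′) n) - (partialF (suc n) ⊛ M) n - Q′
      ≡⟨ cong₂ (λ x y → x - y - Q′) (F-⊛-split m (P m′) n) (F-⊛-truncate M {n} ℕₚ.≤-refl) ⟨
    (F ⊛ P m′) n - (F ⊛ M) n - Q′
      ≡⟨ cong₂ _-_ (⊛-distribˡ-⊖ F (P m′) M n) (Q≗partialF-⊛-P m′ n) ⟨
    (F ⊛ D m) n - Q m n
      ∎
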